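{- Let $\psi$ be an odd positive Eisenstein prime and $m\in\mathbb{N}$. Then $N(\sigma(\psi^m))\equiv 0\pmod 3$ if and only if one of the following holds: (1) $\psi\equiv 1\pmod{1-\omega^2}$ and $m\equiv 2\pmod 3$; (2) $\psi\equiv 2\pmod{1-\omega^2}$ and $m\equiv 1\pmod 2$.
   Context: $\omega=e^{2\pi i/3}$, $N(a+b\omega)=a^2-ab+b^2$, $\mathbb{Z}[\omega]/(1-\omega^2)\cong\mathbb{Z}/3\mathbb{Z}$. Positive primes: $\{a+b\omega: a>b\ge 0\}\cap\{\text{primes of }\mathbb{Z}[\omega]\}$. For a positive prime $\psi$, $\sigma(\psi^m)=\sum_{j=0}^m\psi^j$. Odd means not divisible by $1-\omega^2$. -}

module Defs where

open import Data.Integer using (ℤ; +_; _+_; _-_; _*_; -_; 0ℤ; 1ℤ)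
open import Data.Nat using (ℕ; zero; suc)
open import Data.Product using (_×_; _,_; ∃)
open import Data.Sum using (_⊎_)
open import Relation.Binary.PropositionalEquality using (_≡_)
open import Relation.Nullary using (¬_)

-- Eisenstein integer a + b ω, with ω = e^{2πi/3}, ω² = -1 - ω.
record 𝔼 : Set where
  constructor _+_ω
  field
    re : ℤ
    im : ℤ
open 𝔼 public

infixl 6 _⊕_ _⊖_
infixl 7 _⊗_

_⊕_ : 𝔼 → 𝔼 → 𝔼
(a + b ω) ⊕ (c + d ω) = (a + c) + (b + d) ω

⊖_ : 𝔼 → 𝔼
⊖ (a + b ω) = (- a) + (- b) ω

_⊖_ : 𝔼 → 𝔼 → 𝔼
x ⊖ y = x ⊕ (⊖ y)

-- (a + bω)(c + dω) = ac + (ad + bc)ω + bd ω² = (ac - bd) + (ad + bc - bd) ω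
_⊗_ : 𝔼 → 𝔼 → 𝔼
(a + b ω) ⊗ (c + d ω) = (a * c - b * d) + (a * d + b * c - b * d) ω

𝟘 𝟙 𝟚 : 𝔼
𝟘 = 0ℤ + 0ℤ ω
𝟙 = 1ℤ + 0ℤ ω
𝟚 = (+ 2) + 0ℤ ω

ω𝔼 : 𝔼
ω𝔼 = 0ℤ + 1ℤ ω

λ𝔼 : 𝔼
λ𝔼 = 𝟙 ⊖ (ω𝔼 ⊗ ω𝔼)

N : 𝔼 → ℤ
N (a + b ω) = a * a - a * b + b * b

_∣𝔼_ : 𝔼 → 𝔼 → Set
x ∣𝔼 y = ∃ λ k → y ≡ k ⊗ x

_≡_[mod_] : 𝔼 → 𝔼 → 𝔼 → Set
x ≡ y [mod μ ] = μ ∣𝔼 (x ⊖ y)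

IsUnit : 𝔼 → Set
IsUnit u = u ∣𝔼 𝟙

-- Prime element of ℤ[ω] (ℤ[ω] is a PID, so prime = irreducible)
IsPrime𝔼 : 𝔼 → Set
IsPrime𝔼 p = ¬ (p ≡ 𝟘) × ¬ IsUnit p ×
  (∀ x y → p ∣𝔼 (x ⊗ y) → p ∣𝔼 x ⊎ p ∣𝔼 y)

IsPositive : 𝔼 → Set
IsPositive (a + b ω) = (b Data.Integer.< a) × (0ℤ Data.Integer.≤ b)
  where import Data.Integer

PositivePrime : 𝔼 → Set
PositivePrime ψ = IsPositive ψ × IsPrime𝔼 ψ

Odd𝔼 : 𝔼 → Set
Odd𝔼 ψ = ¬ (λ𝔼 ∣𝔼 ψ)

_^𝔼_ : 𝔼 → ℕ → 𝔼
x ^𝔼 zero = 𝟙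
x ^𝔼 suc n = x ⊗ (x ^𝔼 n)

σpow : 𝔼 → ℕ → 𝔼
σpow ψ zero = 𝟙
σpow ψ (suc m) = σpow ψ m ⊕ (ψ ^𝔼 suc m)

-- Since ω ≡ 1 (mod λ) for λ = 1 − ω², reduction modulo λ is the map a + bω ↦ a + b (mod 3) onto
-- ℤ/3, and N(a + bω) = (a + b)² − 3ab shows that 3 ∣ N(x) exactly when x reduces to 0.  An odd ψ
-- reduces to r = 1 or r = 2, and σ(ψ^m) to the geometric sum 1 + r + ⋯ + r^m in ℤ/3: for r = 1
-- this is m + 1, which vanishes iff m ≡ 2 (mod 3); for r = 2 = −1 it runs 1, 0, 1, 0, …, so it
-- vanishes iff m is odd.
module Submission where

open import Defs
open import Data.Nat using (ℕ; _%_)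
open import Data.Integer using (+_)
open import Data.Integer.Divisibility using (_∣_)
open import Data.Product using (_×_)
open import Data.Sum using (_⊎_)
open import Function.Bundles using (_⇔_)
open import Relation.Binary.PropositionalEquality using (_≡_)

open import Data.Empty using (⊥-elim)
open import Data.Integer as ℤ using (ℤ; 0ℤ)
open import Data.Integer.DivMod using (_%ℕ_; _/ℕ_; a≡a%ℕn+[a/ℕn]*n)
open import Data.Integer.Divisibility.Signed as Signed using (divides; ∣ᵤ⇒∣; ∣⇒∣ᵤ)
open import Data.Integer.Properties using (pos-+; pos-*; +-identityʳ)
open import Data.Integer.Tactic.RingSolver using (solve-∀)
open import Data.Nat as ℕ using (zero; suc; NonZero; _<_; s≤s)
open import Data.Nat.DivMod using (_/_; m≡m%n+[m/n]*n; m%n<n)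
import Data.Nat.Properties as ℕₚ
import Data.Nat.Tactic.RingSolver as ℕ-Solver
open import Data.Product using (∃; _,_)
open import Data.Sum using (inj₁; inj₂)
open import Function.Base using (_∘_; _∘′_)
open import Function.Bundles using (mk⇔; Equivalence)
open import Function.Construct.Composition using (_⇔-∘_)
open import Function.Construct.Symmetry using (⇔-sym)
open import Function.Properties.Equivalence using (⇔-setoid)
open import Relation.Binary.Bundles using (Setoid)
open import Relation.Binary.Core using (_⇒_)
open import Relation.Binary.Definitions using (Reflexive; Symmetric; Transitive)
open import Relation.Binary.Structures using (IsEquivalence)
open import Relation.Binary.PropositionalEquality using (refl; sym; trans; cong; cong₂; subst)
import Relation.Binary.Reasoning.Setoid
open import Relation.Nullary using (¬_; contradiction)
open import Relation.Nullary.Decidable using (False; toWitnessFalse)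
open import Level using (0ℓ)

open Equivalence using (to; from)

module Congruence (n : ℤ) where

  infix 4 _≋_

  -- A record rather than a synonym for n ∣ a − b, so that a and b can be inferred.
  record _≋_ (a b : ℤ) : Set where
    constructor mkCongruent
    field
      divides-difference : n Signed.∣ a ℤ.- b

  open _≋_ public

  ∣-subst : ∀ {a b} → a ≡ b → n Signed.∣ a → n Signed.∣ b
  ∣-subst = subst (n Signed.∣_)

  ≋-reflexive : _≡_ ⇒ _≋_
  ≋-reflexive {a} refl = mkCongruent (divides 0ℤ (a-a≡0*n a n))
    where
    a-a≡0*n : ∀ a n → a ℤ.- a ≡ 0ℤ ℤ.* n
    a-a≡0*n = solve-∀

  ≋-refl : Reflexive _≋_
  ≋-refl = ≋-reflexive refl

  ≋-sym : Symmetric _≋_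
  ≋-sym {a} {b} (mkCongruent n∣a-b) =
    mkCongruent (∣-subst (-[a-b]≡b-a a b) (Signed.∣m⇒∣-m n∣a-b))
    where
    -[a-b]≡b-a : ∀ a b → ℤ.- (a ℤ.- b) ≡ b ℤ.- a
    -[a-b]≡b-a = solve-∀

  ≋-trans : Transitive _≋_
  ≋-trans {a} {b} {c} (mkCongruent n∣a-b) (mkCongruent n∣b-c) =
    mkCongruent (∣-subst (telescope a b c) (Signed.∣m∣n⇒∣m+n n∣a-b n∣b-c))
    where
    telescope : ∀ a b c → (a ℤ.- b) ℤ.+ (b ℤ.- c) ≡ a ℤ.- c
    telescope = solve-∀

  +-cong : ∀ {a b c d} → a ≋ b → c ≋ d → a ℤ.+ c ≋ b ℤ.+ d
  +-cong {a} {b} {c} {d} (mkCongruent n∣a-b) (mkCongruent n∣c-d) =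
    mkCongruent (∣-subst (regroup a b c d) (Signed.∣m∣n⇒∣m+n n∣a-b n∣c-d))
    where
    regroup : ∀ a b c d → (a ℤ.- b) ℤ.+ (c ℤ.- d) ≡ (a ℤ.+ c) ℤ.- (b ℤ.+ d)
    regroup = solve-∀

  *-cong : ∀ {a b c d} → a ≋ b → c ≋ d → a ℤ.* c ≋ b ℤ.* d
  *-cong {a} {b} {c} {d} (mkCongruent n∣a-b) (mkCongruent n∣c-d) =
    mkCongruent (∣-subst (regroup a b c d)
      (Signed.∣m∣n⇒∣m+n (Signed.∣m⇒∣m*n c n∣a-b) (Signed.∣n⇒∣m*n b n∣c-d)))
    where
    regroup : ∀ a b c d → (a ℤ.- b) ℤ.* c ℤ.+ b ℤ.* (c ℤ.- d) ≡ a ℤ.* c ℤ.- b ℤ.* d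
    regroup = solve-∀

  ≋-isEquivalence : IsEquivalence _≋_
  ≋-isEquivalence = record { refl = ≋-refl ; sym = ≋-sym ; trans = ≋-trans }

  ≋-setoid : Setoid 0ℓ 0ℓ
  ≋-setoid = record { isEquivalence = ≋-isEquivalence }

  ≋-respˡ : ∀ {a b c} → a ≋ b → a ≋ c ⇔ b ≋ c
  ≋-respˡ a≋b = mk⇔ (≋-trans (≋-sym a≋b)) (≋-trans a≋b)

  ≋-respʳ : ∀ {a b c} → b ≋ c → a ≋ b ⇔ a ≋ c
  ≋-respʳ b≋c = mk⇔ (λ a≋b → ≋-trans a≋b b≋c) (λ a≋c → ≋-trans a≋c (≋-sym b≋c))

  ≋0⇔∣ : ∀ {a} → a ≋ 0ℤ ⇔ n Signed.∣ a
  ≋0⇔∣ {a} = mk⇔ (∣-subst (+-identityʳ a) ∘ divides-difference)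
                 (mkCongruent ∘ ∣-subst (sym (+-identityʳ a)))

open Congruence (+ 3)

data ℤ₃ : Set where
  0₃ 1₃ 2₃ : ℤ₃

toℕ₃ : ℤ₃ → ℕ
toℕ₃ 0₃ = 0
toℕ₃ 1₃ = 1
toℕ₃ 2₃ = 2

fromℕ₃ : ℕ → ℤ₃
fromℕ₃ 0 = 0₃
fromℕ₃ 1 = 1₃
fromℕ₃ 2 = 2₃
fromℕ₃ (suc (suc (suc k))) = fromℕ₃ k

⟦_⟧ : ℤ₃ → ℤ
⟦ r ⟧ = + toℕ₃ r

infixl 6 _+₃_
infixl 7 _*₃_

_+₃_ _*₃_ : ℤ₃ → ℤ₃ → ℤ₃
r +₃ s = fromℕ₃ (toℕ₃ r ℕ.+ toℕ₃ s)
r *₃ s = fromℕ₃ (toℕ₃ r ℕ.* toℕ₃ s)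

⟦fromℕ₃⟧ : ∀ k → ⟦ fromℕ₃ k ⟧ ≋ + k
⟦fromℕ₃⟧ 0 = ≋-refl
⟦fromℕ₃⟧ 1 = ≋-refl
⟦fromℕ₃⟧ 2 = ≋-refl
⟦fromℕ₃⟧ (suc (suc (suc k))) = ≋-trans (⟦fromℕ₃⟧ k) k≋3+k
  where
  k-[3+k]≡-1*3 : ∀ k → k ℤ.- (+ 3 ℤ.+ k) ≡ ℤ.- + 1 ℤ.* + 3
  k-[3+k]≡-1*3 = solve-∀
  k≋3+k : + k ≋ + (3 ℕ.+ k)
  k≋3+k = mkCongruent (divides (ℤ.- + 1)
    (subst (λ t → + k ℤ.- t ≡ ℤ.- + 1 ℤ.* + 3) (pos-+ 3 k) (k-[3+k]≡-1*3 (+ k))))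

⟦⟧-+ : ∀ r s → ⟦ r +₃ s ⟧ ≋ ⟦ r ⟧ ℤ.+ ⟦ s ⟧
⟦⟧-+ r s = ≋-trans (⟦fromℕ₃⟧ _) (≋-reflexive (pos-+ (toℕ₃ r) (toℕ₃ s)))

⟦⟧-* : ∀ r s → ⟦ r *₃ s ⟧ ≋ ⟦ r ⟧ ℤ.* ⟦ s ⟧
⟦⟧-* r s = ≋-trans (⟦fromℕ₃⟧ _) (≋-reflexive (pos-* (toℕ₃ r) (toℕ₃ s)))

residue : ∀ x → ∃ λ r → x ≋ ⟦ r ⟧
residue x = fromℕ₃ (x %ℕ 3) , ≋-trans x≋x%3 (≋-sym (⟦fromℕ₃⟧ (x %ℕ 3)))
  where
  remainder : ∀ x r q → x ≡ r ℤ.+ q ℤ.* + 3 → x ℤ.- r ≡ q ℤ.* + 3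
  remainder _ r q refl = r+3q-r≡3q r q
    where
    r+3q-r≡3q : ∀ r q → (r ℤ.+ q ℤ.* + 3) ℤ.- r ≡ q ℤ.* + 3
    r+3q-r≡3q = solve-∀
  x≋x%3 : x ≋ + (x %ℕ 3)
  x≋x%3 = mkCongruent (divides (x /ℕ 3) (remainder x (+ (x %ℕ 3)) (x /ℕ 3) (a≡a%ℕn+[a/ℕn]*n x 3)))

3∤-by-computation : ∀ {x} {_ : False (+ 3 Signed.∣? x)} → ¬ + 3 Signed.∣ x
3∤-by-computation {_} {3∤x} = toWitnessFalse 3∤x

⟦⟧-injective : ∀ r s → ⟦ r ⟧ ≋ ⟦ s ⟧ → r ≡ s
⟦⟧-injective 0₃ 0₃ _ = refl
⟦⟧-injective 1₃ 1₃ _ = refl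
⟦⟧-injective 2₃ 2₃ _ = refl
⟦⟧-injective 0₃ 1₃ (mkCongruent p) = contradiction p 3∤-by-computation
⟦⟧-injective 0₃ 2₃ (mkCongruent p) = contradiction p 3∤-by-computation
⟦⟧-injective 1₃ 0₃ (mkCongruent p) = contradiction p 3∤-by-computation
⟦⟧-injective 1₃ 2₃ (mkCongruent p) = contradiction p 3∤-by-computation
⟦⟧-injective 2₃ 0₃ (mkCongruent p) = contradiction p 3∤-by-computation
⟦⟧-injective 2₃ 1₃ (mkCongruent p) = contradiction p 3∤-by-computation

⟦⟧-≋⇔≡ : ∀ {r s} → ⟦ r ⟧ ≋ ⟦ s ⟧ ⇔ r ≡ s
⟦⟧-≋⇔≡ {r} {s} = mk⇔ (⟦⟧-injective r s) (≋-reflexive ∘ cong ⟦_⟧)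

*₃-self≡0⇔≡0 : ∀ s → s *₃ s ≡ 0₃ ⇔ s ≡ 0₃
*₃-self≡0⇔≡0 0₃ = mk⇔ (λ _ → refl) (λ _ → refl)
*₃-self≡0⇔≡0 1₃ = mk⇔ (λ ()) (λ ())
*₃-self≡0⇔≡0 2₃ = mk⇔ (λ ()) (λ ())

infixr 8 _^₃_

_^₃_ : ℤ₃ → ℕ → ℤ₃
r ^₃ zero = 1₃
r ^₃ suc j = r *₃ r ^₃ j

σ₃ : ℤ₃ → ℕ → ℤ₃
σ₃ r zero = 1₃
σ₃ r (suc m) = σ₃ r m +₃ r ^₃ suc m

module ≋-Reasoning = Relation.Binary.Reasoning.Setoid ≋-setoid
module ⇔-Reasoning = Relation.Binary.Reasoning.Setoid (⇔-setoid 0ℓ)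

reduce : 𝔼 → ℤ
reduce x = re x ℤ.+ im x

reduce-⊕ : ∀ x y → reduce (x ⊕ y) ≡ reduce x ℤ.+ reduce y
reduce-⊕ (a + b ω) (c + d ω) = regroup a b c d
  where
  regroup : ∀ a b c d → (a ℤ.+ c) ℤ.+ (b ℤ.+ d) ≡ (a ℤ.+ b) ℤ.+ (c ℤ.+ d)
  regroup = solve-∀

reduce-⊖ : ∀ x y → reduce (x ⊖ y) ≡ reduce x ℤ.- reduce y
reduce-⊖ (a + b ω) (c + d ω) = regroup a b c d
  where
  regroup : ∀ a b c d → (a ℤ.- c) ℤ.+ (b ℤ.- d) ≡ (a ℤ.+ b) ℤ.- (c ℤ.+ d)
  regroup = solve-∀

reduce-⊗ : ∀ x y → reduce (x ⊗ y) ≋ reduce x ℤ.* reduce y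
reduce-⊗ (a + b ω) (c + d ω) = mkCongruent (divides (ℤ.- (b ℤ.* d)) (expand a b c d))
  where
  expand : ∀ a b c d →
    ((a ℤ.* c ℤ.- b ℤ.* d) ℤ.+ (a ℤ.* d ℤ.+ b ℤ.* c ℤ.- b ℤ.* d)) ℤ.- (a ℤ.+ b) ℤ.* (c ℤ.+ d)
      ≡ ℤ.- (b ℤ.* d) ℤ.* + 3
  expand = solve-∀

N≋reduce² : ∀ x → N x ≋ reduce x ℤ.* reduce x
N≋reduce² (a + b ω) = mkCongruent (divides (ℤ.- (a ℤ.* b)) (expand a b))
  where
  expand : ∀ a b →
    (a ℤ.* a ℤ.- a ℤ.* b ℤ.+ b ℤ.* b) ℤ.- (a ℤ.+ b) ℤ.* (a ℤ.+ b) ≡ ℤ.- (a ℤ.* b) ℤ.* + 3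
  expand = solve-∀

λ∣⇔3∣reduce : ∀ z → λ𝔼 ∣𝔼 z ⇔ + 3 Signed.∣ reduce z
λ∣⇔3∣reduce z = mk⇔ (λ∣⇒3∣reduce z) (3∣reduce⇒λ∣ z)
  where
  λ∣⇒3∣reduce : ∀ z → λ𝔼 ∣𝔼 z → + 3 Signed.∣ reduce z
  λ∣⇒3∣reduce _ (c + d ω , refl) = divides c (expand c d)
    where
    expand : ∀ c d →
      (c ℤ.* + 2 ℤ.- d ℤ.* + 1) ℤ.+ (c ℤ.* + 1 ℤ.+ d ℤ.* + 2 ℤ.- d ℤ.* + 1) ≡ c ℤ.* + 3
    expand = solve-∀
  -- If a + b = 3c then a + bω = (c + (b − c)ω)(2 + ω).
  3∣reduce⇒λ∣ : ∀ z → + 3 Signed.∣ reduce z → λ𝔼 ∣𝔼 z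
  3∣reduce⇒λ∣ (a + b ω) (divides c a+b≡3c) = c + (b ℤ.- c) ω , cong₂ _+_ω re≡ (im≡ b c)
    where
    re≡ : a ≡ c ℤ.* + 2 ℤ.- (b ℤ.- c) ℤ.* + 1
    re≡ = trans (a≡[a+b]-b a b) (trans (cong (ℤ._- b) a+b≡3c) (3c-b≡ b c))
      where
      a≡[a+b]-b : ∀ a b → a ≡ (a ℤ.+ b) ℤ.- b
      a≡[a+b]-b = solve-∀
      3c-b≡ : ∀ b c → c ℤ.* + 3 ℤ.- b ≡ c ℤ.* + 2 ℤ.- (b ℤ.- c) ℤ.* + 1
      3c-b≡ = solve-∀
    im≡ : ∀ b c → b ≡ c ℤ.* + 1 ℤ.+ (b ℤ.- c) ℤ.* + 2 ℤ.- (b ℤ.- c) ℤ.* + 1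
    im≡ = solve-∀

≡[mod-λ]⇔reduce≋ : ∀ x y → x ≡ y [mod λ𝔼 ] ⇔ reduce x ≋ reduce y
≡[mod-λ]⇔reduce≋ x y =
  mk⇔ (mkCongruent ∘ ∣-subst (reduce-⊖ x y)) (∣-subst (sym (reduce-⊖ x y)) ∘ divides-difference)
    ⇔-∘ λ∣⇔3∣reduce (x ⊖ y)

≡[mod-λ]⇔residue≡ : ∀ x r s → reduce x ≋ ⟦ r ⟧ →
  x ≡ ⟦ s ⟧ + 0ℤ ω [mod λ𝔼 ] ⇔ r ≡ s
≡[mod-λ]⇔residue≡ x r s x≋r = begin
  x ≡ ⟦ s ⟧ + 0ℤ ω [mod λ𝔼 ]       ≈⟨ ≡[mod-λ]⇔reduce≋ x (⟦ s ⟧ + 0ℤ ω) ⟩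
  reduce x ≋ ⟦ s ⟧ ℤ.+ 0ℤ         ≈⟨ ≋-respˡ x≋r ⟩
  ⟦ r ⟧ ≋ ⟦ s ⟧ ℤ.+ 0ℤ            ≈⟨ ≋-respʳ (≋-reflexive (+-identityʳ ⟦ s ⟧)) ⟩
  ⟦ r ⟧ ≋ ⟦ s ⟧                   ≈⟨ ⟦⟧-≋⇔≡ ⟩
  r ≡ s                          ∎
  where open ⇔-Reasoning

module _ (ψ : 𝔼) {r : ℤ₃} (ψ≋r : reduce ψ ≋ ⟦ r ⟧) where

  reduce-^𝔼 : ∀ j → reduce (ψ ^𝔼 j) ≋ ⟦ r ^₃ j ⟧
  reduce-^𝔼 zero = ≋-refl
  reduce-^𝔼 (suc j) = begin
    reduce (ψ ⊗ ψ ^𝔼 j)            ≈⟨ reduce-⊗ ψ (ψ ^𝔼 j) ⟩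
    reduce ψ ℤ.* reduce (ψ ^𝔼 j)  ≈⟨ *-cong ψ≋r (reduce-^𝔼 j) ⟩
    ⟦ r ⟧ ℤ.* ⟦ r ^₃ j ⟧            ≈⟨ ≋-sym (⟦⟧-* r (r ^₃ j)) ⟩
    ⟦ r ^₃ suc j ⟧                 ∎
    where open ≋-Reasoning

  reduce-σpow : ∀ m → reduce (σpow ψ m) ≋ ⟦ σ₃ r m ⟧
  reduce-σpow zero = ≋-refl
  reduce-σpow (suc m) = begin
    reduce (σpow ψ m ⊕ ψ ^𝔼 suc m)            ≡⟨ reduce-⊕ (σpow ψ m) (ψ ^𝔼 suc m) ⟩
    reduce (σpow ψ m) ℤ.+ reduce (ψ ^𝔼 suc m) ≈⟨ +-cong (reduce-σpow m) (reduce-^𝔼 (suc m)) ⟩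
    ⟦ σ₃ r m ⟧ ℤ.+ ⟦ r ^₃ suc m ⟧              ≈⟨ ≋-sym (⟦⟧-+ (σ₃ r m) (r ^₃ suc m)) ⟩
    ⟦ σ₃ r (suc m) ⟧                          ∎
    where open ≋-Reasoning

3∣N⇔residue≡0 : ∀ x {s} → reduce x ≋ ⟦ s ⟧ → + 3 ∣ N x ⇔ s ≡ 0₃
3∣N⇔residue≡0 x {s} x≋s = begin
  + 3 ∣ N x              ≈⟨ mk⇔ ∣ᵤ⇒∣ ∣⇒∣ᵤ ⟩
  + 3 Signed.∣ N x       ≈⟨ ⇔-sym ≋0⇔∣ ⟩
  N x ≋ ⟦ 0₃ ⟧            ≈⟨ ≋-respˡ N≋s*s ⟩
  ⟦ s *₃ s ⟧ ≋ ⟦ 0₃ ⟧      ≈⟨ ⟦⟧-≋⇔≡ ⟩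
  s *₃ s ≡ 0₃            ≈⟨ *₃-self≡0⇔≡0 s ⟩
  s ≡ 0₃                 ∎
  where
  open ⇔-Reasoning
  N≋s*s : N x ≋ ⟦ s *₃ s ⟧
  N≋s*s = ≋-trans (N≋reduce² x) (≋-trans (*-cong x≋s x≋s) (≋-sym (⟦⟧-* s s)))

periodic⇒≡at-mod : ∀ {A : Set} (f : ℕ → A) p .{{_ : NonZero p}} →
  (∀ k → f (p ℕ.+ k) ≡ f k) → ∀ m → f m ≡ f (m % p)
periodic⇒≡at-mod f p period m = trans (cong f (m≡m%n+[m/n]*n m p)) (shift (m % p) (m / p))
  where
  rearrange : ∀ r q p → r ℕ.+ (p ℕ.+ q ℕ.* p) ≡ p ℕ.+ (r ℕ.+ q ℕ.* p)
  rearrange = ℕ-Solver.solve-∀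
  shift : ∀ r q → f (r ℕ.+ q ℕ.* p) ≡ f r
  shift r zero = cong f (ℕₚ.+-identityʳ r)
  shift r (suc q) = trans (cong f (rearrange r q p)) (trans (period _) (shift r q))

σ₃-1-period : ∀ k → σ₃ 1₃ (3 ℕ.+ k) ≡ σ₃ 1₃ k
σ₃-1-period k = add-thrice (σ₃ 1₃ k) (1₃ ^₃ k)
  where
  add-thrice : ∀ s p → s +₃ 1₃ *₃ p +₃ 1₃ *₃ (1₃ *₃ p) +₃ 1₃ *₃ (1₃ *₃ (1₃ *₃ p)) ≡ s
  add-thrice 0₃ 0₃ = refl
  add-thrice 0₃ 1₃ = refl
  add-thrice 0₃ 2₃ = refl
  add-thrice 1₃ 0₃ = refl
  add-thrice 1₃ 1₃ = refl
  add-thrice 1₃ 2₃ = refl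
  add-thrice 2₃ 0₃ = refl
  add-thrice 2₃ 1₃ = refl
  add-thrice 2₃ 2₃ = refl

σ₃-2-period : ∀ k → σ₃ 2₃ (2 ℕ.+ k) ≡ σ₃ 2₃ k
σ₃-2-period k = add-twice (σ₃ 2₃ k) (2₃ ^₃ k)
  where
  add-twice : ∀ s p → s +₃ 2₃ *₃ p +₃ 2₃ *₃ (2₃ *₃ p) ≡ s
  add-twice 0₃ 0₃ = refl
  add-twice 0₃ 1₃ = refl
  add-twice 0₃ 2₃ = refl
  add-twice 1₃ 0₃ = refl
  add-twice 1₃ 1₃ = refl
  add-twice 1₃ 2₃ = refl
  add-twice 2₃ 0₃ = refl
  add-twice 2₃ 1₃ = refl
  add-twice 2₃ 2₃ = refl

σ₃-1≡0⇔ : ∀ m → σ₃ 1₃ m ≡ 0₃ ⇔ m % 3 ≡ 2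
σ₃-1≡0⇔ m = subst (λ v → v ≡ 0₃ ⇔ m % 3 ≡ 2) (sym (periodic⇒≡at-mod (σ₃ 1₃) 3 σ₃-1-period m))
  (below-period (m % 3) (m%n<n m 3))
  where
  below-period : ∀ i → i < 3 → σ₃ 1₃ i ≡ 0₃ ⇔ i ≡ 2
  below-period 0 _ = mk⇔ (λ ()) (λ ())
  below-period 1 _ = mk⇔ (λ ()) (λ ())
  below-period 2 _ = mk⇔ (λ _ → refl) (λ _ → refl)
  below-period (suc (suc (suc _))) (s≤s (s≤s (s≤s ())))

σ₃-2≡0⇔ : ∀ m → σ₃ 2₃ m ≡ 0₃ ⇔ m % 2 ≡ 1
σ₃-2≡0⇔ m = subst (λ v → v ≡ 0₃ ⇔ m % 2 ≡ 1) (sym (periodic⇒≡at-mod (σ₃ 2₃) 2 σ₃-2-period m))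
  (below-period (m % 2) (m%n<n m 2))
  where
  below-period : ∀ i → i < 2 → σ₃ 2₃ i ≡ 0₃ ⇔ i ≡ 1
  below-period 0 _ = mk⇔ (λ ()) (λ ())
  below-period 1 _ = mk⇔ (λ _ → refl) (λ _ → refl)
  below-period (suc (suc _)) (s≤s (s≤s ()))

⇔-guarded₁ : ∀ {X P Q A B : Set} → P → ¬ Q → X ⇔ A → X ⇔ ((P × A) ⊎ (Q × B))
⇔-guarded₁ p ¬q x⇔a = mk⇔ (λ x → inj₁ (p , to x⇔a x))
  λ { (inj₁ (_ , a)) → from x⇔a a ; (inj₂ (q , _)) → contradiction q ¬q }

⇔-guarded₂ : ∀ {X P Q A B : Set} → Q → ¬ P → X ⇔ B → X ⇔ ((P × A) ⊎ (Q × B))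
⇔-guarded₂ q ¬p x⇔b = mk⇔ (λ x → inj₂ (q , to x⇔b x))
  λ { (inj₁ (p , _)) → contradiction p ¬p ; (inj₂ (_ , b)) → from x⇔b b }

mainTheorem11 : (ψ : 𝔼) → PositivePrime ψ → Odd𝔼 ψ → (m : ℕ) →
    ((+ 3) ∣ N (σpow ψ m)) ⇔
      ((ψ ≡ 𝟙 [mod λ𝔼 ] × m % 3 ≡ 2) ⊎ (ψ ≡ 𝟚 [mod λ𝔼 ] × m % 2 ≡ 1))
mainTheorem11 ψ _ odd m with residue (reduce ψ)
... | 0₃ , ψ≋0 = ⊥-elim (odd (from (λ∣⇔3∣reduce ψ) (to ≋0⇔∣ ψ≋0)))
... | 1₃ , ψ≋1 = ⇔-guarded₁
  (from (≡[mod-λ]⇔residue≡ ψ 1₃ 1₃ ψ≋1) refl)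
  ((λ ()) ∘′ to (≡[mod-λ]⇔residue≡ ψ 1₃ 2₃ ψ≋1))
  (σ₃-1≡0⇔ m ⇔-∘ 3∣N⇔residue≡0 (σpow ψ m) (reduce-σpow ψ ψ≋1 m))
... | 2₃ , ψ≋2 = ⇔-guarded₂
  (from (≡[mod-λ]⇔residue≡ ψ 2₃ 2₃ ψ≋2) refl)
  ((λ ()) ∘′ to (≡[mod-λ]⇔residue≡ ψ 2₃ 1₃ ψ≋2))
  (σ₃-2≡0⇔ m ⇔-∘ 3∣N⇔residue≡0 (σpow ψ m) (reduce-σpow ψ ψ≋2 m))
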